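{- Let $G$ be an edge-colored graph of order $n\geq 6$ such that $|CN(u)\cup CN(v)|\geq n-1$ for every pair of vertices $u$ and $v$ in $V(G)$. Then $G$ contains a rainbow $C_3$ unless $G$ is a rainbow $K_{\lceil n/2\rceil,\lfloor n/2\rfloor}$.
   Context: Graphs are finite and simple. An edge-colored graph is a graph $G$ with a map $C:E(G)\to\mathbb{N}$. For a vertex $v$, the color neighborhood $CN(v)$ is the set of colors assigned to edges incident to $v$. A (sub)graph is rainbow if all its edges have distinct colors. $C_3$ is a triangle; $K_{a,b}$ is the complete bipartite graph with parts of sizes $a,b$. -}

module Defs where

open import Data.Nat using (ℕ; zero; suc; _+_; _∸_; _≤_; ⌈_/2⌉)
open import Data.Bool using (Bool; true; false; if_then_else_)
open import Data.Fin using (Fin; zero; suc)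
open import Data.List using (List; length)
open import Data.List.Relation.Unary.All using (All)
open import Data.List.Relation.Unary.Unique.Propositional using (Unique)
open import Data.Product using (Σ; ∃; _×_; _,_)
open import Data.Sum using (_⊎_)
open import Relation.Binary.PropositionalEquality using (_≡_; _≢_)

-- Edges: adj u v ≡ true; adj is symmetric and irreflexive.
-- col u v is the color of the edge uv (only meaningful when uv is an edge);
-- it is required to be symmetric on edges.
record EdgeColoredGraph (n : ℕ) : Set where
  field
    adj     : Fin n → Fin n → Bool
    col     : Fin n → Fin n → ℕ
    adj-sym : ∀ u v → adj u v ≡ adj v u
    adj-irr : ∀ v → adj v v ≡ false
    col-sym : ∀ u v → adj u v ≡ true → col u v ≡ col v u
open EdgeColoredGraph public

InCN : ∀ {n} → EdgeColoredGraph n → Fin n → ℕ → Set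
InCN G v c = ∃ λ w → adj G v w ≡ true × col G v w ≡ c

UnionCNAtLeast : ∀ {n} → EdgeColoredGraph n → Fin n → Fin n → ℕ → Set
UnionCNAtLeast G u v k =
  Σ (List ℕ) λ cs → Unique cs × All (λ c → InCN G u c ⊎ InCN G v c) cs × k ≤ length cs

HasRainbowC3 : ∀ {n} → EdgeColoredGraph n → Set
HasRainbowC3 G = ∃ λ a → ∃ λ b → ∃ λ c →
  adj G a b ≡ true × adj G b c ≡ true × adj G a c ≡ true ×
  col G a b ≢ col G b c × col G b c ≢ col G a c × col G a b ≢ col G a c

countTrue : (n : ℕ) → (Fin n → Bool) → ℕ
countTrue zero f = 0
countTrue (suc n) f = (if f zero then 1 else 0) + countTrue n (λ i → f (suc i))

IsRainbowKHalf : ∀ {n} → EdgeColoredGraph n → Set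
IsRainbowKHalf {n} G = Σ (Fin n → Bool) λ side →
  countTrue n side ≡ ⌈ n /2⌉ ×
  (∀ u v → (adj G u v ≡ true) → side u ≢ side v) ×
  (∀ u v → side u ≢ side v → adj G u v ≡ true) ×
  (∀ u v x y → adj G u v ≡ true → adj G x y ≡ true → col G u v ≡ col G x y →
     (u ≡ x × v ≡ y) ⊎ (u ≡ y × v ≡ x))

-- Suppose G has no rainbow triangle. For an edge ab, every other vertex y adds at most one colour
-- besides C(ab) to CN(a) ∪ CN(b), since the triangle a b y repeats a colour; as CN(a) ∪ CN(b) has
-- n − 1 colours, every third vertex z must have an edge to a or b whose colour no other vertex
-- accounts for. Playing this against a repeated colour at a vertex shows that G is properly
-- coloured, hence triangle-free, that every vertex is adjacent to an end of every edge, and that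
-- no two edges share a colour. So N(v₀) and its complement split G as a complete bipartite rainbow
-- graph, and the colour bound for two vertices of one side, whose colours come from edges into the
-- other side, forces both sides to have at least (n − 1)/2 vertices.

module Submission where

open import Defs
open import Data.Bool using (Bool; true; false; not; T)
import Data.Bool as Bool
open import Data.Bool.Properties using (¬-not; not-injective; not-involutive)
open import Data.Empty using (⊥; ⊥-elim)
open import Data.Fin using (Fin; zero; suc)
import Data.Fin.Properties as Fin
open import Data.List using (List; []; _∷_; length; map; _++_; filter; filterᵇ; allFin; tabulate)
open import Data.List.Properties using (filter-notAll; length-tabulate; length-map; length-++)
open import Data.List.Relation.Unary.Any using (here; there)
import Data.List.Relation.Unary.Any as Any
open import Data.List.Relation.Unary.All using ([]; _∷_)
import Data.List.Relation.Unary.All as All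
open import Data.List.Relation.Unary.AllPairs using ([]; _∷_)
open import Data.List.Relation.Unary.Unique.Propositional using (Unique)
open import Data.List.Relation.Unary.Unique.Propositional.Properties using (allFin⁺)
open import Data.List.Relation.Binary.Subset.Propositional using (_⊆_)
open import Data.List.Membership.Propositional using (_∈_; _∉_)
open import Data.List.Membership.Propositional.Properties using (∈-filter⁺; ∈-allFin; ∈-map⁺; ∈-++⁺ˡ; ∈-++⁺ʳ)
import Data.List.Membership.DecPropositional as DecMembership
open import Data.Nat using (ℕ; zero; suc; _+_; _∸_; _≤_; _<_; z≤n; s≤s; s≤s⁻¹; ⌈_/2⌉; _≟_)
open import Data.Nat.Properties using (≤-trans; +-comm; +-suc; +-monoʳ-≤; <⇒≱; 1+n≰n; m≤n+m∸n; +-cancelʳ-≤; module ≤-Reasoning)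
open import Data.Product using (∃; ∃₂; _×_; _,_; proj₁; proj₂)
open import Data.Sum using (_⊎_; inj₁; inj₂; [_,_]′)
open import Data.Unit using (tt)
open import Relation.Binary.Definitions using (DecidableEquality)
open import Relation.Binary.PropositionalEquality
open import Relation.Nullary using (¬_; Dec; yes; no; does; ¬?)
open import Relation.Nullary.Decidable using (dec-true; dec-false; decidable-stable; _×-dec_)

module _ {A : Set} (_≟_ : DecidableEquality A) where

  unique-⊆⇒length-≤ : ∀ {xs ys : List A} → Unique xs → xs ⊆ ys → length xs ≤ length ys
  unique-⊆⇒length-≤ {[]} _ _ = z≤n
  unique-⊆⇒length-≤ {x ∷ xs} {ys} (x∉xs ∷ unique) x∷xs⊆ys =
    ≤-trans (s≤s (unique-⊆⇒length-≤ unique xs⊆ys-x))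
            (filter-notAll x≢? ys (Any.map (λ x≡y x≢y → x≢y x≡y) (x∷xs⊆ys (here refl))))
    where
    x≢? = λ y → ¬? (x ≟ y)
    xs⊆ys-x : xs ⊆ filter x≢? ys
    xs⊆ys-x y∈xs = ∈-filter⁺ x≢? (x∷xs⊆ys (there y∈xs)) (All.lookup x∉xs y∈xs)

length-filterᵇ-tabulate : ∀ {A : Set} n (p : A → Bool) (f : Fin n → A) →
  length (filterᵇ p (tabulate f)) ≡ countTrue n (λ i → p (f i))
length-filterᵇ-tabulate zero p f = refl
length-filterᵇ-tabulate (suc n) p f with p (f zero)
... | true = cong suc (length-filterᵇ-tabulate n p (λ i → f (suc i)))
... | false = length-filterᵇ-tabulate n p (λ i → f (suc i))

module _ {n : ℕ} where

  vertices : (Fin n → Bool) → List (Fin n)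
  vertices S = filterᵇ S (allFin n)

  length-vertices : ∀ S → length (vertices S) ≡ countTrue n S
  length-vertices S = length-filterᵇ-tabulate n S (λ i → i)

  ∈-vertices : ∀ {S x} → S x ≡ true → x ∈ vertices S
  ∈-vertices {S} {x} Sx = ∈-filter⁺ (λ i → Data.Bool.T? (S i)) (∈-allFin x) (subst T (sym Sx) tt)

countTrue-+-complement : ∀ n (S : Fin n → Bool) → countTrue n S + countTrue n (λ i → not (S i)) ≡ n
countTrue-+-complement zero S = refl
countTrue-+-complement (suc n) S with S zero
... | true = cong suc (countTrue-+-complement n (λ i → S (suc i)))
... | false = trans (+-suc _ _) (cong suc (countTrue-+-complement n (λ i → S (suc i))))

countTrue-one : ∀ n (S : Fin n → Bool) → 1 ≤ countTrue n S → ∃ λ x → S x ≡ true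
countTrue-one (suc n) S h with S zero in S0
... | true = zero , S0
... | false = let (x , Sx) = countTrue-one n (λ i → S (suc i)) h in suc x , Sx

countTrue-two : ∀ n (S : Fin n → Bool) → 2 ≤ countTrue n S →
  ∃₂ λ x y → x ≢ y × S x ≡ true × S y ≡ true
countTrue-two (suc n) S h with S zero in S0
... | true = let (y , Sy) = countTrue-one n (λ i → S (suc i)) (s≤s⁻¹ h) in zero , suc y , (λ ()) , S0 , Sy
... | false = let (x , y , x≢y , Sx , Sy) = countTrue-two n (λ i → S (suc i)) h
              in suc x , suc y , (λ e → x≢y (Fin.suc-injective e)) , Sx , Sy

module _ {n : ℕ} where
  open DecMembership (Fin._≟_ {n}) using (_∈?_)

  outside : List (Fin n) → Fin n → Bool
  outside xs y = not (does (y ∈? xs))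

  outside-true : ∀ {xs y} → y ∉ xs → outside xs y ≡ true
  outside-true {xs} {y} y∉xs = cong not (dec-false (y ∈? xs) y∉xs)

  countTrue-outside : ∀ xs → Unique xs → countTrue n (outside xs) + length xs ≤ n
  countTrue-outside xs unique = begin
    countTrue n (outside xs) + length xs        ≤⟨ +-monoʳ-≤ (countTrue n (outside xs)) xs-inside ⟩
    countTrue n (outside xs) + countTrue n inside ≡⟨ +-comm (countTrue n (outside xs)) _ ⟩
    countTrue n inside + countTrue n (outside xs) ≡⟨ countTrue-+-complement n inside ⟩
    n ∎
    where
    open ≤-Reasoning
    inside : Fin n → Bool
    inside y = does (y ∈? xs)
    xs-inside : length xs ≤ countTrue n inside
    xs-inside = subst (length xs ≤_) (length-vertices inside)
      (unique-⊆⇒length-≤ Fin._≟_ unique (λ {y} y∈xs → ∈-vertices {S = inside} (dec-true (y ∈? xs) y∈xs)))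

  ∃-∉ : ∀ xs → length xs < n → ∃ λ k → k ∉ xs
  ∃-∉ xs short with Fin.any? (λ k → ¬? (k ∈? xs))
  ... | yes k∉xs = k∉xs
  ... | no ¬∃ = ⊥-elim (<⇒≱ short (subst (_≤ length xs) (length-tabulate (λ i → i))
      (unique-⊆⇒length-≤ Fin._≟_ (allFin⁺ n)
        (λ {k} _ → decidable-stable (k ∈? xs) (λ k∉xs → ¬∃ (k , k∉xs))))))

m+3≤n⇒n∸1≰1+m : ∀ {n c} → c + 3 ≤ n → ¬ n ∸ 1 ≤ suc c
m+3≤n⇒n∸1≰1+m {n} {c} room short =
  1+n≰n (≤-trans (subst (_≤ n) (+-comm c 3) room) (≤-trans (m≤n+m∸n n 1) (s≤s short)))

4≤n⇒n∸1≰2 : ∀ {n} → 4 ≤ n → ¬ n ∸ 1 ≤ 2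
4≤n⇒n∸1≰2 (s≤s (s≤s (s≤s (s≤s _)))) (s≤s (s≤s ()))

two-≤-part : ∀ {p q n} → p + q ≡ n → 4 ≤ n → (2 ≤ q → n ∸ 1 ≤ p + p) → 2 ≤ p
two-≤-part {suc (suc p)} _ _ _ = s≤s (s≤s z≤n)
two-≤-part {zero} refl 4≤n bound =
  ⊥-elim (4≤n⇒n∸1≰2 4≤n (≤-trans (bound (≤-trans (s≤s (s≤s z≤n)) 4≤n)) z≤n))
two-≤-part {suc zero} refl 4≤n bound =
  ⊥-elim (4≤n⇒n∸1≰2 4≤n (bound (s≤s⁻¹ (≤-trans (s≤s (s≤s (s≤s z≤n))) 4≤n))))

m+n∸1≤n+n⇒m≤1+n : ∀ p q → p + q ∸ 1 ≤ q + q → p ≤ suc q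
m+n∸1≤n+n⇒m≤1+n p q bound = +-cancelʳ-≤ q p (suc q) (≤-trans (m≤n+m∸n (p + q) 1) (s≤s bound))

balanced⇒⌈/2⌉ : ∀ p q → p ≤ suc q → q ≤ suc p → p ≡ ⌈ p + q /2⌉ ⊎ q ≡ ⌈ p + q /2⌉
balanced⇒⌈/2⌉ zero zero _ _ = inj₁ refl
balanced⇒⌈/2⌉ zero (suc zero) _ _ = inj₂ refl
balanced⇒⌈/2⌉ (suc zero) zero _ _ = inj₁ refl
balanced⇒⌈/2⌉ zero (suc (suc q)) _ (s≤s ())
balanced⇒⌈/2⌉ (suc (suc p)) zero (s≤s ()) _
balanced⇒⌈/2⌉ (suc p) (suc q) p≤ q≤ rewrite +-suc p q with balanced⇒⌈/2⌉ p q (s≤s⁻¹ p≤) (s≤s⁻¹ q≤)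
... | inj₁ e = inj₁ (cong suc e)
... | inj₂ e = inj₂ (cong suc e)

near-half : ∀ {p q n} → p + q ≡ n → n ∸ 1 ≤ q + q → n ∸ 1 ≤ p + p → p ≡ ⌈ n /2⌉ ⊎ q ≡ ⌈ n /2⌉
near-half {p} {q} refl q-large p-large =
  balanced⇒⌈/2⌉ p q (m+n∸1≤n+n⇒m≤1+n p q q-large) (m+n∸1≤n+n⇒m≤1+n q p (subst (λ m → m ∸ 1 ≤ p + p) (+-comm p q) p-large))

EveryC3RepeatsColour : ∀ {n} → EdgeColoredGraph n → Set
EveryC3RepeatsColour G = ∀ a b c → adj G a b ≡ true → adj G b c ≡ true → adj G a c ≡ true →
  col G a b ≡ col G b c ⊎ col G b c ≡ col G a c ⊎ col G a b ≡ col G a c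

module WithoutRainbowC3 {n} (4≤n : 4 ≤ n) (G : EdgeColoredGraph n)
  (dense : ∀ u v → u ≢ v → UnionCNAtLeast G u v (n ∸ 1))
  (repeats : EveryC3RepeatsColour G) where

  infix 4 _∼_ _∼?_

  _∼_ : Fin n → Fin n → Set
  u ∼ v = adj G u v ≡ true

  _∼?_ : ∀ u v → Dec (u ∼ v)
  u ∼? v = adj G u v Bool.≟ true

  C : Fin n → Fin n → ℕ
  C = col G

  ∼-sym : ∀ {u v} → u ∼ v → v ∼ u
  ∼-sym {u} {v} uv = trans (adj-sym G v u) uv

  ∼⇒≢ : ∀ {u v} → u ∼ v → u ≢ v
  ∼⇒≢ {u} uu refl with trans (sym (adj-irr G u)) uu
  ... | ()

  C-sym : ∀ {u v} → u ∼ v → C u v ≡ C v u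
  C-sym {u} {v} = col-sym G u v

  colours⊆⇒n∸1≤length : ∀ {u v} → u ≢ v → (K : List ℕ) →
    (∀ c → InCN G u c ⊎ InCN G v c → c ∈ K) → n ∸ 1 ≤ length K
  colours⊆⇒n∸1≤length {u} {v} u≢v K ⊆K with dense u v u≢v
  ... | cs , unique , inCN , n∸1≤ =
    ≤-trans n∸1≤ (unique-⊆⇒length-≤ _≟_ unique (λ {c} c∈cs → ⊆K c (All.lookup inCN c∈cs)))

  -- The only colour other than C a b that the edges ay and by can carry.
  newColour : Fin n → Fin n → Fin n → ℕ
  newColour a b y with a ∼? y | C a y ≟ C a b
  ... | yes _ | no _ = C a y
  ... | _ | _ = C b y

  newColour-via-a : ∀ {a b y} → a ∼ y → C a y ≢ C a b → newColour a b y ≡ C a y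
  newColour-via-a {a} {b} {y} ay ne with a ∼? y | C a y ≟ C a b
  ... | yes _ | no _ = refl
  ... | no ¬ay | _ = ⊥-elim (¬ay ay)
  ... | yes _ | yes e = ⊥-elim (ne e)

  newColour-via-b : ∀ {a b y} → ¬ a ∼ y ⊎ C a y ≡ C a b → newColour a b y ≡ C b y
  newColour-via-b {a} {b} {y} h with a ∼? y | C a y ≟ C a b
  ... | no _ | _ = refl
  ... | yes _ | yes _ = refl
  ... | yes ay | no ne = ⊥-elim ([ (λ ¬ay → ¬ay ay) , ne ]′ h)

  colour-via-a : ∀ {a b y} → a ∼ y → C a y ≡ C a b ⊎ C a y ≡ newColour a b y
  colour-via-a {a} {b} {y} ay = decide (C a y ≟ C a b)
    where
    decide : Dec (C a y ≡ C a b) → C a y ≡ C a b ⊎ C a y ≡ newColour a b y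
    decide (yes e) = inj₁ e
    decide (no ne) = inj₂ (sym (newColour-via-a ay ne))

  colour-via-b : ∀ {a b y} → a ∼ b → b ∼ y → C b y ≡ C a b ⊎ C b y ≡ newColour a b y
  colour-via-b {a} {b} {y} ab by = decide (a ∼? y) (C a y ≟ C a b)
    where
    decide : Dec (a ∼ y) → Dec (C a y ≡ C a b) → C b y ≡ C a b ⊎ C b y ≡ newColour a b y
    decide (no ¬ay) _ = inj₂ (sym (newColour-via-b (inj₁ ¬ay)))
    decide (yes _) (yes e) = inj₂ (sym (newColour-via-b (inj₂ e)))
    decide (yes ay) (no ne) with repeats a b y ab by ay
    ... | inj₁ ab≡by = inj₁ (sym ab≡by)
    ... | inj₂ (inj₁ by≡ay) = inj₂ (trans by≡ay (sym (newColour-via-a ay ne)))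
    ... | inj₂ (inj₂ ab≡ay) = ⊥-elim (ne (sym ab≡ay))

  -- Contains every colour of CN(a) ∪ CN(b) not carried by az or bz, yet has only n − 2 entries.
  spectrum : Fin n → Fin n → Fin n → List ℕ
  spectrum a b z = C a b ∷ map (newColour a b) (vertices (outside (a ∷ b ∷ z ∷ [])))

  ∉-triple : ∀ {y a b z : Fin n} → y ≢ a → y ≢ b → y ≢ z → y ∉ a ∷ b ∷ z ∷ []
  ∉-triple y≢a _ _ (here e) = y≢a e
  ∉-triple _ y≢b _ (there (here e)) = y≢b e
  ∉-triple _ _ y≢z (there (there (here e))) = y≢z e

  ∈-spectrum : ∀ {a b z y c} → y ≢ a → y ≢ b → y ≢ z → c ≡ newColour a b y → c ∈ spectrum a b z
  ∈-spectrum y≢a y≢b y≢z refl =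
    there (∈-map⁺ _ (∈-vertices (outside-true (∉-triple y≢a y≢b y≢z))))

  third-vertex-adds-colour : ∀ {a b z} → a ∼ b → z ≢ a → z ≢ b →
    (a ∼ z → C a z ∈ spectrum a b z) → (b ∼ z → C b z ∈ spectrum a b z) → ⊥
  third-vertex-adds-colour {a} {b} {z} ab z≢a z≢b via-a via-b =
    m+3≤n⇒n∸1≰1+m room
      (subst (n ∸ 1 ≤_) length-spectrum (colours⊆⇒n∸1≤length (∼⇒≢ ab) (spectrum a b z) covered))
    where
    room : countTrue n (outside (a ∷ b ∷ z ∷ [])) + 3 ≤ n
    room = countTrue-outside (a ∷ b ∷ z ∷ [])
      ((∼⇒≢ ab ∷ ≢-sym z≢a ∷ []) ∷ (≢-sym z≢b ∷ []) ∷ [] ∷ [])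
    length-spectrum : length (spectrum a b z) ≡ suc (countTrue n (outside (a ∷ b ∷ z ∷ [])))
    length-spectrum = cong suc (trans (length-map (newColour a b) (vertices (outside (a ∷ b ∷ z ∷ []))))
      (length-vertices (outside (a ∷ b ∷ z ∷ []))))
    covered : ∀ c → InCN G a c ⊎ InCN G b c → c ∈ spectrum a b z
    covered _ (inj₁ (w , aw , refl)) with w Fin.≟ b | w Fin.≟ z
    ... | yes refl | _ = here refl
    ... | no _ | yes refl = via-a aw
    ... | no w≢b | no w≢z =
      [ here , ∈-spectrum (≢-sym (∼⇒≢ aw)) w≢b w≢z ]′ (colour-via-a aw)
    covered _ (inj₂ (w , bw , refl)) with w Fin.≟ a | w Fin.≟ z
    ... | yes refl | _ = here (sym (C-sym ab))
    ... | no _ | yes refl = via-b bw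
    ... | no w≢a | no w≢z =
      [ here , ∈-spectrum w≢a (≢-sym (∼⇒≢ bw)) w≢z ]′ (colour-via-b ab bw)

  equal-colours⇒adjacent : ∀ {u v w} → u ∼ v → u ∼ w → v ≢ w → C u w ≡ C u v → v ∼ w
  equal-colours⇒adjacent {u} {v} {w} uv uw v≢w uw≡uv with v ∼? w
  ... | yes vw = vw
  ... | no ¬vw = ⊥-elim (third-vertex-adds-colour uv (≢-sym (∼⇒≢ uw)) (≢-sym v≢w)
                          (λ _ → here uw≡uv) (λ vw → ⊥-elim (¬vw vw)))

  monochromatic-star⇒C≢ : ∀ {u v w x} → u ∼ v → u ∼ w → u ∼ x → v ≢ w → x ≢ v → x ≢ w →
    C u w ≡ C u v → C u x ≡ C u v → C v w ≢ C v x
  monochromatic-star⇒C≢ {u} {v} {w} {x} uv uw ux v≢w x≢v x≢w uw≡uv ux≡uv vw≡vx =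
    third-vertex-adds-colour uv (≢-sym (∼⇒≢ uw)) (≢-sym v≢w) (λ _ → here uw≡uv)
      (λ _ → ∈-spectrum (≢-sym (∼⇒≢ ux)) x≢v x≢w (trans vw≡vx (sym (newColour-via-b (inj₂ ux≡uv)))))

  no-monochromatic-3-star : ∀ {u v w x} → u ∼ v → u ∼ w → u ∼ x → v ≢ w → x ≢ v → x ≢ w →
    C u w ≡ C u v → C u x ≡ C u v → ⊥
  no-monochromatic-3-star {u} {v} {w} {x} uv uw ux v≢w x≢v x≢w uw≡uv ux≡uv =
    [ (λ vw≡wx → star-at-w (trans (sym (C-sym vw)) vw≡wx))
    , [ (λ wx≡vx → star-at-x (trans (sym (C-sym vx)) (trans (sym wx≡vx) (C-sym wx))))
      , star-at-v ]′ ]′ (repeats v w x vw wx vx)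
    where
    ux≡uw = trans ux≡uv (sym uw≡uv)
    vw = equal-colours⇒adjacent uv uw v≢w uw≡uv
    wx = equal-colours⇒adjacent uw ux (≢-sym x≢w) ux≡uw
    vx = equal-colours⇒adjacent uv ux (≢-sym x≢v) ux≡uv
    star-at-v = monochromatic-star⇒C≢ uv uw ux v≢w x≢v x≢w uw≡uv ux≡uv
    star-at-w = monochromatic-star⇒C≢ uw uv ux (≢-sym v≢w) x≢w x≢v (sym uw≡uv) ux≡uw
    star-at-x = monochromatic-star⇒C≢ ux uv uw x≢v (≢-sym x≢w) (≢-sym v≢w) (sym ux≡uv) (sym ux≡uw)

  monochromatic-cherry⇒no-third-colour : ∀ {u v w x} → u ∼ v → u ∼ w → u ∼ x → v ≢ w → x ≢ v → x ≢ w →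
    C u w ≡ C u v → C u x ≢ C u v → ⊥
  monochromatic-cherry⇒no-third-colour {u} {v} {w} {x} uv uw ux v≢w x≢v x≢w uw≡uv ux≢uv =
    third-vertex-adds-colour ux (≢-sym (∼⇒≢ uv)) (≢-sym x≢v) (λ _ → uv∈) via-x
    where
    uv∈ : C u v ∈ spectrum u x v
    uv∈ = ∈-spectrum (≢-sym (∼⇒≢ uw)) (≢-sym x≢w) (≢-sym v≢w)
      (trans (sym uw≡uv) (sym (newColour-via-a uw (λ uw≡ux → ux≢uv (trans (sym uw≡ux) uw≡uv)))))
    via-repeat : x ∼ v → C x v ≢ C u x → C x v ∈ spectrum u x v
    via-repeat xv xv≢ux with repeats u v x uv (∼-sym xv) ux
    ... | inj₁ uv≡vx = subst (_∈ spectrum u x v) (trans uv≡vx (sym (C-sym xv))) uv∈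
    ... | inj₂ (inj₁ vx≡ux) = ⊥-elim (xv≢ux (trans (C-sym xv) vx≡ux))
    ... | inj₂ (inj₂ uv≡ux) = ⊥-elim (ux≢uv (sym uv≡ux))
    via-x : x ∼ v → C x v ∈ spectrum u x v
    via-x xv with C x v ≟ C u x
    ... | yes xv≡ux = here xv≡ux
    ... | no xv≢ux = via-repeat xv xv≢ux

  monochromatic-cherry⇒neighbours : ∀ {u v w x} → u ∼ v → u ∼ w → v ≢ w → C u w ≡ C u v →
    u ∼ x → x ≡ v ⊎ x ≡ w
  monochromatic-cherry⇒neighbours {u} {v} {w} {x} uv uw v≢w uw≡uv ux with x Fin.≟ v | x Fin.≟ w
  ... | yes x≡v | _ = inj₁ x≡v
  ... | no _ | yes x≡w = inj₂ x≡w
  ... | no x≢v | no x≢w with C u x ≟ C u v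
  ...   | yes ux≡uv = ⊥-elim (no-monochromatic-3-star uv uw ux v≢w x≢v x≢w uw≡uv ux≡uv)
  ...   | no ux≢uv = ⊥-elim (monochromatic-cherry⇒no-third-colour uv uw ux v≢w x≢v x≢w uw≡uv ux≢uv)

  monochromatic-cherry⇒outsider : ∀ {u v w x} → u ∼ v → u ∼ w → v ≢ w → C u w ≡ C u v →
    ¬ u ∼ x → x ≢ u → x ≢ v → x ≢ w → v ∼ x × C v x ≢ C v w
  monochromatic-cherry⇒outsider {u} {v} {w} {x} uv uw v≢w uw≡uv ¬ux x≢u x≢v x≢w with v ∼? x
  ... | no ¬vx = ⊥-elim (third-vertex-adds-colour uv x≢u x≢v (λ ux → ⊥-elim (¬ux ux)) (λ vx → ⊥-elim (¬vx vx)))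
  ... | yes vx = vx , λ vx≡vw → third-vertex-adds-colour uv x≢u x≢v (λ ux → ⊥-elim (¬ux ux))
      (λ _ → ∈-spectrum (≢-sym (∼⇒≢ uw)) (≢-sym v≢w) (≢-sym x≢w)
               (trans vx≡vw (sym (newColour-via-b (inj₂ uw≡uv)))))

  no-monochromatic-cherry : ∀ {u v w} → u ∼ v → u ∼ w → v ≢ w → C u w ≡ C u v → ⊥
  no-monochromatic-cherry {u} {v} {w} uv uw v≢w uw≡uv =
    4≤n⇒n∸1≰2 4≤n (colours⊆⇒n∸1≤length (≢-sym x≢u) (C u v ∷ C x v ∷ []) covered)
    where
    fresh = ∃-∉ (u ∷ v ∷ w ∷ []) 4≤n
    x = proj₁ fresh
    x≢u : x ≢ u
    x≢u x≡u = proj₂ fresh (here x≡u)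
    x≢v : x ≢ v
    x≢v x≡v = proj₂ fresh (there (here x≡v))
    x≢w : x ≢ w
    x≢w x≡w = proj₂ fresh (there (there (here x≡w)))
    ¬ux : ¬ u ∼ x
    ¬ux ux = [ x≢v , x≢w ]′ (monochromatic-cherry⇒neighbours uv uw v≢w uw≡uv ux)
    vw = equal-colours⇒adjacent uv uw v≢w uw≡uv
    v-side = monochromatic-cherry⇒outsider uv uw v≢w uw≡uv ¬ux x≢u x≢v x≢w
    w-side = monochromatic-cherry⇒outsider uw uv (≢-sym v≢w) (sym uw≡uv) ¬ux x≢u x≢w x≢v
    vx = proj₁ v-side
    wx = proj₁ w-side
    xw≡xv : C x w ≡ C x v
    xw≡xv =
      [ (λ vw≡wx → ⊥-elim (proj₂ w-side (trans (sym vw≡wx) (C-sym vw))))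
      , [ (λ wx≡vx → trans (sym (C-sym wx)) (trans wx≡vx (C-sym vx)))
        , (λ vw≡vx → ⊥-elim (proj₂ v-side (sym vw≡vx))) ]′ ]′ (repeats v w x vw wx vx)
    covered : ∀ c → InCN G u c ⊎ InCN G x c → c ∈ C u v ∷ C x v ∷ []
    covered _ (inj₁ (y , uy , refl)) =
      [ (λ y≡v → here (cong (C u) y≡v)) , (λ y≡w → here (trans (cong (C u) y≡w) uw≡uv)) ]′
        (monochromatic-cherry⇒neighbours uv uw v≢w uw≡uv uy)
    covered _ (inj₂ (y , xy , refl)) =
      [ (λ y≡v → there (here (cong (C x) y≡v))) , (λ y≡w → there (here (trans (cong (C x) y≡w) xw≡xv))) ]′
        (monochromatic-cherry⇒neighbours (∼-sym vx) (∼-sym wx) v≢w xw≡xv xy)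

  properly-coloured : ∀ {u v w} → u ∼ v → u ∼ w → C u w ≡ C u v → v ≡ w
  properly-coloured {v = v} {w} uv uw uw≡uv with v Fin.≟ w
  ... | yes v≡w = v≡w
  ... | no v≢w = ⊥-elim (no-monochromatic-cherry uv uw v≢w uw≡uv)

  triangle-free : ∀ {a b c} → a ∼ b → b ∼ c → a ∼ c → ⊥
  triangle-free {a} {b} {c} ab bc ac with repeats a b c ab bc ac
  ... | inj₁ ab≡bc = ∼⇒≢ ac (properly-coloured (∼-sym ab) bc (trans (sym ab≡bc) (C-sym ab)))
  ... | inj₂ (inj₁ bc≡ac) =
    ∼⇒≢ ab (sym (properly-coloured (∼-sym bc) (∼-sym ac) (trans (sym (C-sym ac)) (trans (sym bc≡ac) (C-sym bc)))))
  ... | inj₂ (inj₂ ab≡ac) = ∼⇒≢ bc (properly-coloured ab ac (sym ab≡ac))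

  edge-dominates : ∀ {a b x} → a ∼ b → x ≢ a → x ≢ b → a ∼ x ⊎ b ∼ x
  edge-dominates {a} {b} {x} ab x≢a x≢b with a ∼? x | b ∼? x
  ... | yes ax | _ = inj₁ ax
  ... | no _ | yes bx = inj₂ bx
  ... | no ¬ax | no ¬bx = ⊥-elim (third-vertex-adds-colour ab x≢a x≢b (λ ax → ⊥-elim (¬ax ax)) (λ bx → ⊥-elim (¬bx bx)))

  disjoint-edges-differ : ∀ {u v x y} → u ∼ v → x ∼ y → y ∼ u → x ≢ u → v ≢ x → v ≢ y → C u v ≢ C x y
  disjoint-edges-differ {u} {v} {x} {y} uv xy yu x≢u v≢x v≢y uv≡xy =
    third-vertex-adds-colour (∼-sym yu) (≢-sym (∼⇒≢ uv)) v≢y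
      (λ _ → ∈-spectrum x≢u (∼⇒≢ xy) (≢-sym v≢x)
               (trans uv≡xy (trans (C-sym xy) (sym (newColour-via-b (inj₁ ¬ux))))))
      (λ yv → ⊥-elim (triangle-free uv (∼-sym yv) (∼-sym yu)))
    where
    ¬ux : ¬ u ∼ x
    ¬ux ux = triangle-free ux xy (∼-sym yu)

  no-repeated-colour : ∀ {u v x y} → u ∼ v → x ∼ y → C u v ≡ C x y → (u ≡ x × v ≡ y) ⊎ (u ≡ y × v ≡ x)
  no-repeated-colour {u} {v} {x} {y} uv xy uv≡xy with u Fin.≟ x | u Fin.≟ y | v Fin.≟ x | v Fin.≟ y
  ... | yes refl | _ | _ | _ = inj₁ (refl , properly-coloured uv xy (sym uv≡xy))
  ... | no _ | yes refl | _ | _ = inj₂ (refl , properly-coloured uv (∼-sym xy) (sym (trans uv≡xy (C-sym xy))))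
  ... | no _ | no _ | yes refl | _ =
    inj₂ (properly-coloured (∼-sym uv) xy (sym (trans (sym (C-sym uv)) uv≡xy)) , refl)
  ... | no _ | no _ | no _ | yes refl =
    inj₁ (properly-coloured (∼-sym uv) (∼-sym xy) (sym (trans (sym (C-sym uv)) (trans uv≡xy (C-sym xy)))) , refl)
  ... | no u≢x | no u≢y | no v≢x | no v≢y with edge-dominates xy u≢x u≢y
  ...   | inj₁ xu = ⊥-elim (disjoint-edges-differ uv (∼-sym xy) xu (≢-sym u≢y) v≢y v≢x (trans uv≡xy (C-sym xy)))
  ...   | inj₂ yu = ⊥-elim (disjoint-edges-differ uv xy yu (≢-sym u≢x) v≢x v≢y uv≡xy)

  neighbourhoods⊆⇒n∸1≤ : ∀ {a a'} (B : Fin n → Bool) → a ≢ a' →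
    (∀ {y} → a ∼ y → B y ≡ true) → (∀ {y} → a' ∼ y → B y ≡ true) →
    n ∸ 1 ≤ countTrue n B + countTrue n B
  neighbourhoods⊆⇒n∸1≤ {a} {a'} B a≢a' a⇒B a'⇒B =
    subst (n ∸ 1 ≤_) length-colours (colours⊆⇒n∸1≤length a≢a' colours covered)
    where
    colours = map (C a) (vertices B) ++ map (C a') (vertices B)
    length-colours : length colours ≡ countTrue n B + countTrue n B
    length-colours = trans (length-++ (map (C a) (vertices B)))
      (cong₂ _+_ (trans (length-map (C a) (vertices B)) (length-vertices B))
                 (trans (length-map (C a') (vertices B)) (length-vertices B)))
    covered : ∀ c → InCN G a c ⊎ InCN G a' c → c ∈ colours
    covered _ (inj₁ (y , ay , refl)) = ∈-++⁺ˡ (∈-map⁺ (C a) (∈-vertices (a⇒B ay)))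
    covered _ (inj₂ (y , a'y , refl)) = ∈-++⁺ʳ (map (C a) (vertices B)) (∈-map⁺ (C a') (∈-vertices (a'⇒B a'y)))

  module Bipartition {u₀ v₀} (u₀v₀ : u₀ ∼ v₀) where

    side : Fin n → Bool
    side x = adj G v₀ x

    non-neighbour-of-v₀ : ∀ {x} → ¬ v₀ ∼ x → x ≡ v₀ ⊎ u₀ ∼ x
    non-neighbour-of-v₀ {x} ¬v₀x with x Fin.≟ v₀ | x Fin.≟ u₀
    ... | yes x≡v₀ | _ = inj₁ x≡v₀
    ... | no _ | yes refl = ⊥-elim (¬v₀x (∼-sym u₀v₀))
    ... | no x≢v₀ | no x≢u₀ = inj₂ ([ (λ u₀x → u₀x) , (λ v₀x → ⊥-elim (¬v₀x v₀x)) ]′ (edge-dominates u₀v₀ x≢u₀ x≢v₀))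

    edge⇒sides-differ : ∀ x y → x ∼ y → side x ≢ side y
    edge⇒sides-differ x y xy sx≡sy with v₀ ∼? x
    ... | yes v₀x = triangle-free v₀x xy (trans (sym sx≡sy) v₀x)
    ... | no ¬v₀x = via-u₀ (non-neighbour-of-v₀ ¬v₀x) (non-neighbour-of-v₀ ¬v₀y)
      where
      ¬v₀y : ¬ v₀ ∼ y
      ¬v₀y v₀y = ¬v₀x (trans sx≡sy v₀y)
      via-u₀ : x ≡ v₀ ⊎ u₀ ∼ x → y ≡ v₀ ⊎ u₀ ∼ y → ⊥
      via-u₀ (inj₁ x≡v₀) _ = ¬v₀y (subst (_∼ y) x≡v₀ xy)
      via-u₀ _ (inj₁ y≡v₀) = ¬v₀x (subst (_∼ x) y≡v₀ (∼-sym xy))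
      via-u₀ (inj₂ u₀x) (inj₂ u₀y) = triangle-free u₀x xy u₀y

    neighbour⇒edge-to-non-neighbour : ∀ {x y} → v₀ ∼ x → ¬ v₀ ∼ y → x ∼ y
    neighbour⇒edge-to-non-neighbour {x} {y} v₀x ¬v₀y with y Fin.≟ v₀
    ... | yes refl = ∼-sym v₀x
    ... | no y≢v₀ = [ (λ v₀y → ⊥-elim (¬v₀y v₀y)) , (λ xy → xy) ]′ (edge-dominates v₀x y≢v₀ y≢x)
      where
      y≢x : y ≢ x
      y≢x y≡x = ¬v₀y (subst (v₀ ∼_) (sym y≡x) v₀x)

    sides-differ⇒edge : ∀ x y → side x ≢ side y → x ∼ y
    sides-differ⇒edge x y sx≢sy with v₀ ∼? x | v₀ ∼? y
    ... | yes v₀x | yes v₀y = ⊥-elim (sx≢sy (trans v₀x (sym v₀y)))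
    ... | yes v₀x | no ¬v₀y = neighbour⇒edge-to-non-neighbour v₀x ¬v₀y
    ... | no ¬v₀x | yes v₀y = ∼-sym (neighbour⇒edge-to-non-neighbour v₀y ¬v₀x)
    ... | no ¬v₀x | no ¬v₀y = ⊥-elim (sx≢sy (trans (¬-not ¬v₀x) (sym (¬-not ¬v₀y))))

    side-of-neighbour : ∀ {x y} → x ∼ y → side y ≡ not (side x)
    side-of-neighbour {x} {y} xy = ¬-not (λ sy≡sx → edge⇒sides-differ x y xy (sym sy≡sx))

    p = countTrue n side
    q = countTrue n (λ x → not (side x))

    p+q≡n : p + q ≡ n
    p+q≡n = countTrue-+-complement n side

    q-large : 2 ≤ p → n ∸ 1 ≤ q + q
    q-large 2≤p with countTrue-two n side 2≤p
    ... | a , a' , a≢a' , sa , sa' = neighbourhoods⊆⇒n∸1≤ _ a≢a' (across sa) (across sa')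
      where
      across : ∀ {x y} → side x ≡ true → x ∼ y → not (side y) ≡ true
      across {x} sx xy = trans (cong not (side-of-neighbour xy)) (trans (not-involutive (side x)) sx)

    p-large : 2 ≤ q → n ∸ 1 ≤ p + p
    p-large 2≤q with countTrue-two n _ 2≤q
    ... | a , a' , a≢a' , sa , sa' = neighbourhoods⊆⇒n∸1≤ side a≢a' (across sa) (across sa')
      where
      across : ∀ {x y} → not (side x) ≡ true → x ∼ y → side y ≡ true
      across nsx xy = trans (side-of-neighbour xy) nsx

    isRainbowKHalf : IsRainbowKHalf G
    isRainbowKHalf with near-half p+q≡n (q-large (two-≤-part p+q≡n 4≤n p-large))
                         (p-large (two-≤-part (trans (+-comm q p) p+q≡n) 4≤n q-large))
    ... | inj₁ p≡⌈n/2⌉ = side , p≡⌈n/2⌉ , edge⇒sides-differ , sides-differ⇒edge , λ _ _ _ _ → no-repeated-colour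
    ... | inj₂ q≡⌈n/2⌉ = (λ x → not (side x)) , q≡⌈n/2⌉
        , (λ x y xy nsx≡nsy → edge⇒sides-differ x y xy (not-injective nsx≡nsy))
        , (λ x y nsx≢nsy → sides-differ⇒edge x y (λ sx≡sy → nsx≢nsy (cong not sx≡sy)))
        , λ _ _ _ _ → no-repeated-colour

  some-edge : ∃ λ a → ∃ λ b → a ∼ b
  some-edge = edge-in (dense u v (λ u≡v → proj₂ v-fresh (here (sym u≡v))))
    where
    u = proj₁ (∃-∉ [] (≤-trans (s≤s z≤n) 4≤n))
    v-fresh = ∃-∉ (u ∷ []) (≤-trans (s≤s (s≤s z≤n)) 4≤n)
    v = proj₁ v-fresh
    edge-in : UnionCNAtLeast G u v (n ∸ 1) → ∃ λ a → ∃ λ b → a ∼ b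
    edge-in ([] , _ , _ , n∸1≤0) = ⊥-elim (4≤n⇒n∸1≰2 4≤n (≤-trans n∸1≤0 z≤n))
    edge-in (_ ∷ _ , _ , inj₁ (w , uw , _) ∷ _ , _) = u , w , uw
    edge-in (_ ∷ _ , _ , inj₂ (w , vw , _) ∷ _ , _) = v , w , vw

  isRainbowKHalf : IsRainbowKHalf G
  isRainbowKHalf = Bipartition.isRainbowKHalf (proj₂ (proj₂ some-edge))

hasRainbowC3? : ∀ {n} (G : EdgeColoredGraph n) → Dec (HasRainbowC3 G)
hasRainbowC3? G = Fin.any? λ a → Fin.any? λ b → Fin.any? λ c →
  (adj G a b Bool.≟ true) ×-dec (adj G b c Bool.≟ true) ×-dec (adj G a c Bool.≟ true) ×-dec
  ¬? (col G a b ≟ col G b c) ×-dec ¬? (col G b c ≟ col G a c) ×-dec ¬? (col G a b ≟ col G a c)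

¬HasRainbowC3⇒EveryC3RepeatsColour : ∀ {n} (G : EdgeColoredGraph n) → ¬ HasRainbowC3 G → EveryC3RepeatsColour G
¬HasRainbowC3⇒EveryC3RepeatsColour G ¬rainbow a b c ab bc ac
  with col G a b ≟ col G b c | col G b c ≟ col G a c | col G a b ≟ col G a c
... | yes ab≡bc | _ | _ = inj₁ ab≡bc
... | no _ | yes bc≡ac | _ = inj₂ (inj₁ bc≡ac)
... | no _ | no _ | yes ab≡ac = inj₂ (inj₂ ab≡ac)
... | no ab≢bc | no bc≢ac | no ab≢ac = ⊥-elim (¬rainbow (a , b , c , ab , bc , ac , ab≢bc , bc≢ac , ab≢ac))

theorem7 : (n : ℕ) → 6 ≤ n → (G : EdgeColoredGraph n) →
    (∀ (u v : Fin n) → u ≢ v → UnionCNAtLeast G u v (n ∸ 1)) →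
    ¬ IsRainbowKHalf G → HasRainbowC3 G
theorem7 n 6≤n G dense ¬K with hasRainbowC3? G
... | yes rainbow = rainbow
... | no ¬rainbow = ⊥-elim (¬K (WithoutRainbowC3.isRainbowKHalf 4≤n G dense
                                 (¬HasRainbowC3⇒EveryC3RepeatsColour G ¬rainbow)))
  where
  4≤n : 4 ≤ n
  4≤n = ≤-trans (s≤s (s≤s (s≤s (s≤s z≤n)))) 6≤n
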